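{- Let $A$ be a regular system of divisors, and let $g,g_A:\mathbb N\to\mathbb C$ satisfy \[ \sum_{d\mid n}g(d)=\sum_{d\in A(n)}g_A(d)\quad\text{for every } n\in\mathbb N. \] Then for every $n\in\mathbb N$, \[ g_A(n)=\sum_{\substack{d\mid n\\ \gamma_A(n)\mid d}}g(d). \]
   Context: A regular system of divisors is a family $A=(A(n))_{n\in\mathbb N}$, where each $A(n)$ is a set of positive divisors of $n$, such that: (i) $A(1)=\{1\}$ and $A(mn)=\{de: d\in A(m), e\in A(n)\}$ whenever $\gcd(m,n)=1$; (ii) for every prime power $p^a$ ($a\ge1$) there is a divisor $t=t_A(p^a)$ of $a$ (the type of $p^a$) such that $A(p^{it})=\{1,p^t,\dots,p^{it}\}$ for every $0\le i\le a/t$. The $A$-core is $\gamma_A(n)=\prod_{p^a\parallel n}p^{a-t_A(p^a)+1}$, the product over the prime powers exactly dividing $n$. -}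

module Defs where

open import Level using (Level)
open import Data.Nat using (ℕ; zero; suc; _+_; _*_; _∸_; _^_; _≤_; _≟_)
open import Data.Nat.Divisibility using (_∣_; _∣?_)
open import Data.Nat.DivMod using (_/_)
open import Data.Nat.Coprimality using (Coprime)
open import Data.Nat.Primality using (Prime; prime?)
open import Data.List using (List; map; filter; foldr; upTo)
open import Data.Nat.ListAction using (product)
open import Data.Product using (_×_; ∃-syntax)
open import Relation.Nullary using (Dec; yes; no)
open import Relation.Nullary.Decidable using (_×-dec_)
open import Relation.Binary.PropositionalEquality using (_≡_)
open import Function.Bundles using (_⇔_)
open import Algebra.Bundles using (AbelianGroup)

-- Membership "d ∈ A(n)" is the relation
-- d ∈A n (decidable, so that sums over A(n) make sense).  Conditions are
-- imposed for positive n only (the paper indexes by positive integers).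
record RegularSystem : Set₁ where
  field
    _∈A_  : ℕ → ℕ → Set
    _∈A?_ : ∀ d n → Dec (d ∈A n)
    sub   : ∀ {d n} → 1 ≤ n → d ∈A n → d ∣ n
    one   : ∀ d → (d ∈A 1) ⇔ (d ≡ 1)
    mult  : ∀ m n → 1 ≤ m → 1 ≤ n → Coprime m n → ∀ k →
            (k ∈A (m * n)) ⇔ (∃[ d ] ∃[ e ] (d ∈A m × e ∈A n × k ≡ d * e))
    -- (ii) the type t_A(p^a), given as a function of p and a
    type     : ℕ → ℕ → ℕ
    type-div : ∀ p a → Prime p → 1 ≤ a → type p a ∣ a
    type-pow : ∀ p a → Prime p → 1 ≤ a → ∀ i → i * type p a ≤ a → ∀ k →
               (k ∈A (p ^ (i * type p a))) ⇔ (∃[ j ] (j ≤ i × k ≡ p ^ (j * type p a)))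

-- p-adic valuation (with fuel); v p n = exponent of p in n, for p ≥ 2, n ≥ 1.
val : ℕ → ℕ → ℕ → ℕ
val zero _ _ = 0
val (suc f) zero _ = 0
val (suc f) (suc zero) _ = 0
val (suc f) (suc (suc q)) zero = 0
val (suc f) (suc (suc q)) (suc m) with suc (suc q) ∣? suc m
... | yes _ = suc (val f (suc (suc q)) (suc m / suc (suc q)))
... | no _ = 0

v : ℕ → ℕ → ℕ
v p n = val n p n

range1 : ℕ → List ℕ
range1 n = map suc (upTo n)

primeDivisors : ℕ → List ℕ
primeDivisors n = filter (λ p → prime? p ×-dec (p ∣? n)) (range1 n)

core : RegularSystem → ℕ → ℕ
core A n = product (map (λ p → p ^ (v p n ∸ RegularSystem.type A p (v p n) + 1))
                        (primeDivisors n))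

module Sums {c ℓ : Level} (G : AbelianGroup c ℓ) where
  open AbelianGroup G
  sumL : List Carrier → Carrier
  sumL = foldr _∙_ ε

  sumDiv : ℕ → (ℕ → Carrier) → Carrier
  sumDiv n g = sumL (map g (filter (_∣? n) (range1 n)))

  sumA : RegularSystem → ℕ → (ℕ → Carrier) → Carrier
  sumA A n g = sumL (map g (filter (λ d → RegularSystem._∈A?_ A d n) (range1 n)))

  sumDivMult : ℕ → ℕ → (ℕ → Carrier) → Carrier
  sumDivMult n c g = sumL (map g (filter (λ d → (d ∣? n) ×-dec (c ∣? d)) (range1 n)))

-- Every divisor d of n is covered by exactly one e ∈ A(n), meaning d ∣ e and γ_A(e) ∣ d.
-- Write n = q^a m with q ∤ m and t = t_A(q^a). Then A(n) consists of the q^(it) y with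
-- it ≤ a and y ∈ A(m), and t_A(q^(it)) = t because, by (ii) for q^a, A(q^(it)) consists of
-- the powers q^(jt). So at the prime q the conditions on e read (i-1)t < v_q(d) ≤ it, which
-- pins down i, and away from q they are the same problem for d's q-free part and m.
-- Summing over covers, Σ_{e∈A(n)} Σ_{d∣e, γ_A(e)∣d} g(d) = Σ_{d∣n} g(d) = Σ_{e∈A(n)} g_A(e),
-- and since n ∈ A(n), sums over A(n) determine a function by induction on n.

module Submission where

open import Level using (Level; 0ℓ)
open import Data.Nat using (ℕ; zero; suc; _+_; _*_; _∸_; _^_; _≤_; _<_; _≤?_; _≟_; z≤n; s≤s;
  >-nonZero; nonTrivial⇒n>1)
open import Data.Nat.Properties
open import Data.Nat.Divisibility
open import Data.Nat.Coprimality using (Coprime; coprime-divisor) renaming (sym to coprime-sym)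
open import Data.Nat.Primality using (Prime; prime?; euclidsLemma; ¬prime[0]; ¬prime[1];
  prime⇒irreducible; prime⇒nonZero; prime⇒nonTrivial)
open import Data.Nat.Primality.Factorisation using (factorise)
open import Data.Nat.Induction using (<-rec)
open import Data.Nat.ListAction using (product)
open import Data.Nat.Solver using (module +-*-Solver)
open import Data.List using (List; []; _∷_; map; filter; foldr; upTo; _++_; [_])
open import Data.List.Properties using (upTo-∷ʳ; map-++)
open import Data.List.Relation.Unary.All using (_∷_)
open import Data.Product using (_×_; _,_; proj₁; ∃-syntax)
open import Data.Sum using (inj₁; inj₂; [_,_]′)
open import Data.Empty using (⊥-elim)
open import Relation.Nullary using (¬_; Dec; yes; no)
open import Relation.Nullary.Decidable using (_×-dec_)
open import Relation.Unary using (Pred; Decidable)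
open import Relation.Binary.Definitions using (tri<; tri≈; tri>)
open import Relation.Binary.PropositionalEquality
  using (_≡_; _≢_; ≢-sym; refl; sym; trans; cong; cong₂; subst; subst₂; module ≡-Reasoning)
open import Function.Bundles using (_⇔_; mk⇔; Equivalence)
open import Algebra.Bundles using (CommutativeMonoid; AbelianGroup)
open import Defs

open Equivalence using (to; from)

module FiniteSums {c ℓ : Level} (M : CommutativeMonoid c ℓ) where
  open CommutativeMonoid M renaming (refl to ≈-refl; sym to ≈-sym; trans to ≈-trans)
  open import Relation.Binary.Reasoning.Setoid setoid
  open import Algebra.Solver.CommutativeMonoid M using (solve; _⊕_; _⊜_)

  sumList : List Carrier → Carrier
  sumList = foldr _∙_ ε

  when : ∀ {p} {P : Set p} → Dec P → Carrier → Carrier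
  when (yes _) x = x
  when (no _)  x = ε

  sumTo : ℕ → (ℕ → Carrier) → Carrier
  sumTo zero    f = ε
  sumTo (suc n) f = sumTo n f ∙ f (suc n)

  sumList-map-filter : ∀ {p} {P : Pred ℕ p} (P? : Decidable P) (f : ℕ → Carrier) xs →
                       sumList (map f (filter P? xs)) ≈ sumList (map (λ d → when (P? d) (f d)) xs)
  sumList-map-filter P? f [] = ≈-refl
  sumList-map-filter P? f (x ∷ xs) with P? x
  ... | yes _ = ∙-congˡ (sumList-map-filter P? f xs)
  ... | no _  = ≈-trans (sumList-map-filter P? f xs) (≈-sym (identityˡ _))

  sumList-map-∷ʳ : ∀ (f : ℕ → Carrier) xs x → sumList (map f (xs ++ [ x ])) ≈ sumList (map f xs) ∙ f x
  sumList-map-∷ʳ f []       x = ≈-trans (identityʳ _) (≈-sym (identityˡ _))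
  sumList-map-∷ʳ f (y ∷ xs) x = ≈-trans (∙-congˡ (sumList-map-∷ʳ f xs x)) (≈-sym (assoc _ _ _))

  sumList-map-range1 : ∀ (f : ℕ → Carrier) n → sumList (map f (range1 n)) ≈ sumTo n f
  sumList-map-range1 f zero    = ≈-refl
  sumList-map-range1 f (suc n) = begin
    sumList (map f (map suc (upTo (suc n))))
      ≡⟨ cong (λ l → sumList (map f (map suc l))) (sym (upTo-∷ʳ n)) ⟩
    sumList (map f (map suc (upTo n ++ [ n ])))
      ≡⟨ cong (λ l → sumList (map f l)) (map-++ suc (upTo n) [ n ]) ⟩
    sumList (map f (range1 n ++ [ suc n ]))
      ≈⟨ sumList-map-∷ʳ f (range1 n) (suc n) ⟩
    sumList (map f (range1 n)) ∙ f (suc n)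
      ≈⟨ ∙-congʳ (sumList-map-range1 f n) ⟩
    sumTo (suc n) f ∎

  sumList-filter-range1 : ∀ {p} {P : Pred ℕ p} (P? : Decidable P) (f : ℕ → Carrier) n →
                          sumList (map f (filter P? (range1 n))) ≈ sumTo n (λ d → when (P? d) (f d))
  sumList-filter-range1 P? f n = ≈-trans (sumList-map-filter P? f (range1 n)) (sumList-map-range1 _ n)

  sumTo-cong : ∀ n {f h : ℕ → Carrier} → (∀ d → 1 ≤ d → d ≤ n → f d ≈ h d) → sumTo n f ≈ sumTo n h
  sumTo-cong zero    f≈h = ≈-refl
  sumTo-cong (suc n) f≈h =
    ∙-cong (sumTo-cong n (λ d 1≤d d≤n → f≈h d 1≤d (m≤n⇒m≤1+n d≤n))) (f≈h (suc n) (s≤s z≤n) ≤-refl)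

  sumTo-ε : ∀ n {f : ℕ → Carrier} → (∀ d → 1 ≤ d → d ≤ n → f d ≈ ε) → sumTo n f ≈ ε
  sumTo-ε zero    f≈ε = ≈-refl
  sumTo-ε (suc n) f≈ε =
    ≈-trans (∙-cong (sumTo-ε n (λ d 1≤d d≤n → f≈ε d 1≤d (m≤n⇒m≤1+n d≤n))) (f≈ε (suc n) (s≤s z≤n) ≤-refl))
            (identityˡ ε)

  sumTo-∙ : ∀ n (f h : ℕ → Carrier) → sumTo n (λ d → f d ∙ h d) ≈ sumTo n f ∙ sumTo n h
  sumTo-∙ zero    f h = ≈-sym (identityˡ ε)
  sumTo-∙ (suc n) f h = ≈-trans (∙-congʳ (sumTo-∙ n f h))
    (solve 4 (λ a b x y → (a ⊕ b) ⊕ (x ⊕ y) ⊜ (a ⊕ x) ⊕ (b ⊕ y)) ≈-refl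
       (sumTo n f) (sumTo n h) (f (suc n)) (h (suc n)))

  sumTo-comm : ∀ m n (F : ℕ → ℕ → Carrier) →
               sumTo m (λ e → sumTo n (F e)) ≈ sumTo n (λ d → sumTo m (λ e → F e d))
  sumTo-comm zero    n F = ≈-sym (sumTo-ε n (λ _ _ _ → ≈-refl))
  sumTo-comm (suc m) n F =
    ≈-trans (∙-congʳ (sumTo-comm m n F)) (≈-sym (sumTo-∙ n _ (F (suc m))))

  sumTo-extend : ∀ {m n} {f : ℕ → Carrier} → m ≤ n → (∀ d → m < d → d ≤ n → f d ≈ ε) →
                 sumTo m f ≈ sumTo n f
  sumTo-extend {m} {zero}  z≤n   _   = ≈-refl
  sumTo-extend {m} {suc n} m≤1+n f≈ε with m ≟ suc n
  ... | yes refl   = ≈-refl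
  ... | no m≢1+n   = begin
    sumTo m _        ≈⟨ sumTo-extend m≤n (λ d m<d d≤n → f≈ε d m<d (m≤n⇒m≤1+n d≤n)) ⟩
    sumTo n _        ≈⟨ ≈-sym (identityʳ _) ⟩
    sumTo n _ ∙ ε    ≈⟨ ∙-congˡ (≈-sym (f≈ε (suc n) (s≤s m≤n) ≤-refl)) ⟩
    sumTo (suc n) _  ∎
    where
    m≤n : m ≤ n
    m≤n = ≤-pred (≤∧≢⇒< m≤1+n m≢1+n)

  sumTo-single : ∀ n w {f : ℕ → Carrier} → 1 ≤ w → w ≤ n →
                 (∀ d → 1 ≤ d → d ≤ n → d ≢ w → f d ≈ ε) → sumTo n f ≈ f w
  sumTo-single zero    w () z≤n
  sumTo-single (suc n) w 1≤w w≤1+n f≈ε with w ≟ suc n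
  ... | yes refl = ≈-trans
    (∙-congʳ (sumTo-ε n (λ d 1≤d d≤n → f≈ε d 1≤d (m≤n⇒m≤1+n d≤n) (<⇒≢ (s≤s d≤n)))))
    (identityˡ _)
  ... | no w≢1+n = ≈-trans
    (∙-cong (sumTo-single n w 1≤w (≤-pred (≤∧≢⇒< w≤1+n w≢1+n)) (λ d 1≤d d≤n → f≈ε d 1≤d (m≤n⇒m≤1+n d≤n)))
            (f≈ε (suc n) (s≤s z≤n) ≤-refl (≢-sym w≢1+n)))
    (identityʳ _)

prime>1 : ∀ {p} → Prime p → 1 < p
prime>1 {p} pr = nonTrivial⇒n>1 p {{prime⇒nonTrivial pr}}

∤⇒>0 : ∀ {p n} → ¬ p ∣ n → 0 < n
∤⇒>0 {p} {zero}  p∤0 = ⊥-elim (p∤0 (p ∣0))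
∤⇒>0 {p} {suc n} _   = s≤s z≤n

∣⇒>0 : ∀ {m n} → m ∣ n → 0 < n → 0 < m
∣⇒>0 {zero}  m∣n 0<n = ⊥-elim (<⇒≢ 0<n (sym (0∣⇒≡0 m∣n)))
∣⇒>0 {suc m} _   _   = s≤s z≤n

^*>0 : ∀ {q y} b → Prime q → 0 < y → 0 < q ^ b * y
^*>0 {q} b pq 0<y = *-mono-≤ (m^n>0 q {{prime⇒nonZero pq}} b) 0<y

^∣^ : ∀ p {j k} → j ≤ k → p ^ j ∣ p ^ k
^∣^ p {j} {k} j≤k = divides (p ^ (k ∸ j))
  (trans (cong (p ^_) (sym (m∸n+n≡m j≤k))) (^-distribˡ-+-* p (k ∸ j) j))

∣^* : ∀ p b m → 0 < b → p ∣ p ^ b * m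
∣^* p b m 0<b = ∣-trans (∣-trans (m∣m*n 1) (^∣^ p 0<b)) (m∣m*n m)

∃prime∣ : ∀ {n} → 1 < n → ∃[ p ] (Prime p × p ∣ n)
∃prime∣ {suc zero} (s≤s ())
∃prime∣ {suc (suc k)} _ with factorise (suc (suc k))
... | record { factors = [] ; isFactorisation = () }
... | record { factors = p ∷ ps ; isFactorisation = eq ; factorsPrime = pr ∷ _ } =
  p , pr , divides (product ps) (trans eq (*-comm p (product ps)))

prime∣prime⇒≡ : ∀ {r q} → Prime r → Prime q → r ∣ q → r ≡ q
prime∣prime⇒≡ pr pq r∣q with prime⇒irreducible pq r∣q
... | inj₁ refl = ⊥-elim (¬prime[1] pr)
... | inj₂ r≡q  = r≡q

prime∣^⇒≡ : ∀ {r q} b → Prime r → Prime q → r ∣ q ^ b → r ≡ q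
prime∣^⇒≡ zero    pr pq r∣1 = ⊥-elim (¬prime[1] (subst Prime (∣1⇒≡1 r∣1) pr))
prime∣^⇒≡ {q = q} (suc b) pr pq r∣q^[1+b] with euclidsLemma q (q ^ b) pr r∣q^[1+b]
... | inj₁ r∣q   = prime∣prime⇒≡ pr pq r∣q
... | inj₂ r∣q^b = prime∣^⇒≡ b pr pq r∣q^b

coprime-^ : ∀ {p x} k → Prime p → ¬ p ∣ x → Coprime (p ^ k) x
coprime-^ k pr p∤x {zero}  (_ , 0∣x) = ⊥-elim (p∤x (subst (_ ∣_) (sym (0∣⇒≡0 0∣x)) (_ ∣0)))
coprime-^ k pr p∤x {suc zero} _ = refl
coprime-^ k pr p∤x {suc (suc d)} (d∣p^k , d∣x) with ∃prime∣ {suc (suc d)} (s≤s (s≤s z≤n))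
... | r , rp , r∣d with prime∣^⇒≡ k rp pr (∣-trans r∣d d∣p^k)
... | refl = ⊥-elim (p∤x (∣-trans r∣d d∣x))

coprime-*∣ : ∀ {a b d} → Coprime a b → a ∣ d → b ∣ d → a * b ∣ d
coprime-*∣ {a} {b} cop (divides x refl) b∣xa = subst (_∣ x * a) (*-comm b a) (*-monoˡ-∣ a b∣x)
  where
  b∣x : b ∣ x
  b∣x = coprime-divisor (coprime-sym cop) (subst (b ∣_) (*-comm x a) b∣xa)

-- p-adic valuations

infix 4 _^_∥_
_^_∥_ : ℕ → ℕ → ℕ → Set
p ^ k ∥ n = ∃[ m ] (n ≡ p ^ k * m × ¬ p ∣ m)

^*-injective : ∀ {p m m'} j k → Prime p → ¬ p ∣ m → ¬ p ∣ m' → p ^ j * m ≡ p ^ k * m' → j ≡ k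
^*-injective zero zero _ _ _ _ = refl
^*-injective {p} {m} {m'} zero (suc k) _ p∤m _ e =
  ⊥-elim (p∤m (subst (p ∣_) (trans (sym e) (*-identityˡ m)) (∣^* p (suc k) m' (s≤s z≤n))))
^*-injective {p} {m} {m'} (suc j) zero _ _ p∤m' e =
  ⊥-elim (p∤m' (subst (p ∣_) (trans e (*-identityˡ m')) (∣^* p (suc j) m (s≤s z≤n))))
^*-injective {p} {m} {m'} (suc j) (suc k) pr p∤m p∤m' e = cong suc (^*-injective j k pr p∤m p∤m'
  (*-cancelˡ-≡ _ _ p {{prime⇒nonZero pr}}
    (trans (sym (*-assoc p (p ^ j) m)) (trans e (*-assoc p (p ^ k) m')))))

^-injective : ∀ {p} j k → Prime p → p ^ j ≡ p ^ k → j ≡ k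
^-injective {p} j k pr e =
  ^*-injective j k pr p∤1 p∤1 (trans (*-identityʳ _) (trans e (sym (*-identityʳ _))))
  where
  p∤1 : ¬ p ∣ 1
  p∤1 p∣1 = ¬prime[1] (subst Prime (∣1⇒≡1 p∣1) pr)

∥-unique : ∀ {p n j k} → Prime p → p ^ j ∥ n → p ^ k ∥ n → j ≡ k
∥-unique {j = j} {k} pr (m , refl , p∤m) (m' , e , p∤m') = ^*-injective j k pr p∤m p∤m' e

val-∥ : ∀ q f n → 0 < n → n ≤ f → suc (suc q) ^ val f (suc (suc q)) n ∥ n
val-∥ q (suc f) (suc n) _ (s≤s n≤f) with suc (suc q) ∣? suc n
... | no p∤n = suc n , sym (*-identityˡ (suc n)) , p∤n
... | yes p∣n rewrite n/m≡quotient p∣n {{_}}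
  with val-∥ q f (quotient p∣n) (∣⇒>0 (quotient-∣ p∣n) (s≤s z≤n)) (≤-trans (≤-pred (quotient-< p∣n)) n≤f)
... | m , eq , p∤m =
  m , trans (m∣n⇒n≡m*quotient p∣n) (trans (cong (suc (suc q) *_) eq) (sym (*-assoc (suc (suc q)) p^v m))) ,
  p∤m
  where
  p^v : ℕ
  p^v = suc (suc q) ^ val f (suc (suc q)) (quotient p∣n)

v-∥ : ∀ {p n} → Prime p → 0 < n → p ^ v p n ∥ n
v-∥ {zero}          pr = ⊥-elim (¬prime[0] pr)
v-∥ {suc zero}      pr = ⊥-elim (¬prime[1] pr)
v-∥ {suc (suc q)} {n} _ 0<n = val-∥ q n n 0<n ≤-refl

∥⇒v≡ : ∀ {p n k} → Prime p → 0 < n → p ^ k ∥ n → v p n ≡ k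
∥⇒v≡ pr 0<n p^k∥n = ∥-unique pr (v-∥ pr 0<n) p^k∥n

∥-* : ∀ {p x y j k} → Prime p → p ^ j ∥ x → p ^ k ∥ y → p ^ (j + k) ∥ x * y
∥-* {p} {j = j} {k} pr (m , refl , p∤m) (m' , refl , p∤m') =
  m * m' , eq , λ p∣mm' → [ p∤m , p∤m' ]′ (euclidsLemma m m' pr p∣mm')
  where
  open +-*-Solver using (solve; _:*_; _:=_)
  eq : p ^ j * m * (p ^ k * m') ≡ p ^ (j + k) * (m * m')
  eq rewrite ^-distribˡ-+-* p j k =
    solve 4 (λ x y u w → x :* u :* (y :* w) := x :* y :* (u :* w)) refl (p ^ j) (p ^ k) m m'

^∣⇒≤ : ∀ {p n j k} → Prime p → p ^ k ∥ n → p ^ j ∣ n → j ≤ k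
^∣⇒≤ {p} {n} {j} {k} pr (m , refl , p∤m) p^j∣n with j ≤? k
... | yes j≤k = j≤k
... | no  j≰k = ⊥-elim (p∤m (*-cancelˡ-∣ (p ^ k) {{m^n≢0 p k {{prime⇒nonZero pr}}}} p^k*p∣p^k*m))
  where
  p^k*p∣p^k*m : p ^ k * p ∣ p ^ k * m
  p^k*p∣p^k*m = subst (_∣ p ^ k * m) (*-comm p (p ^ k)) (∣-trans (^∣^ p (≰⇒> j≰k)) p^j∣n)

≤⇒^∣ : ∀ {p n j k} → p ^ k ∥ n → j ≤ k → p ^ j ∣ n
≤⇒^∣ {p} (m , refl , _) j≤k = ∣-trans (^∣^ p j≤k) (m∣m*n m)

^*∣^*⇒ : ∀ {q d' y j b} → Prime q → ¬ q ∣ d' → ¬ q ∣ y → q ^ j * d' ∣ q ^ b * y → j ≤ b × d' ∣ y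
^*∣^*⇒ {q} {d'} {y} {j} {b} pq q∤d' q∤y d∣e =
  ^∣⇒≤ pq (y , refl , q∤y) (∣-trans (m∣m*n d') d∣e) ,
  coprime-divisor (coprime-sym (coprime-^ b pq q∤d')) (∣-trans (n∣m*n (q ^ j)) d∣e)

^*∣^*⇐ : ∀ {q d' y j b} → j ≤ b → d' ∣ y → q ^ j * d' ∣ q ^ b * y
^*∣^*⇐ {q} j≤b d'∣y = *-pres-∣ (^∣^ q j≤b) d'∣y

v-^* : ∀ {q y} b → Prime q → ¬ q ∣ y → v q (q ^ b * y) ≡ b
v-^* b pq q∤y = ∥⇒v≡ pq (^*>0 b pq (∤⇒>0 q∤y)) (_ , refl , q∤y)

v-^*-≢ : ∀ {r q y} b → Prime r → Prime q → r ≢ q → 0 < y → v r (q ^ b * y) ≡ v r y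
v-^*-≢ {r} {q} {y} b pr pq r≢q 0<y =
  ∥⇒v≡ pr (^*>0 b pq 0<y) (∥-* {j = 0} {k = v r y} pr r^0∥q^b (v-∥ pr 0<y))
  where
  r^0∥q^b : r ^ 0 ∥ q ^ b
  r^0∥q^b = q ^ b , sym (*-identityˡ (q ^ b)) , λ r∣q^b → r≢q (prime∣^⇒≡ b pr pq r∣q^b)

factor-induction : ∀ {ℓ} (P : ℕ → Set ℓ) → P 1 →
                   (∀ {q a m} → Prime q → 0 < a → ¬ q ∣ m → P m → P (q ^ a * m)) →
                   ∀ n → 0 < n → P n
factor-induction P P1 step = <-rec (λ n → 0 < n → P n) go
  where
  go : ∀ n → (∀ {m} → m < n → 0 < m → P m) → 0 < n → P n
  go (suc zero)    _  _ = P1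
  go n@(suc (suc _)) IH _ with ∃prime∣ {n} (s≤s (s≤s z≤n))
  ... | q , pq , q∣n with v-∥ pq (s≤s z≤n)
  ... | m , n≡q^a*m , q∤m = subst P (sym n≡q^a*m) (step pq 0<a q∤m (IH m<n (∤⇒>0 q∤m)))
    where
    0<a : 0 < v q n
    0<a = ^∣⇒≤ pq (m , n≡q^a*m , q∤m) (subst (_∣ n) (sym (*-identityʳ q)) q∣n)
    m<n : m < n
    m<n = subst (m <_) (trans (*-comm m _) (sym n≡q^a*m))
      (m<m*n m (q ^ v q n) {{>-nonZero (∤⇒>0 q∤m)}} (<-≤-trans (prime>1 pq) q≤q^a))
      where
      q≤q^a : q ≤ q ^ v q n
      q≤q^a = subst (_≤ q ^ v q n) (*-identityʳ q) (^-monoʳ-≤ q {{prime⇒nonZero pq}} 0<a)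

ceiling-exists : ∀ {t a j} → 0 < t → t ∣ a → j ≤ a → ∃[ i ] (i * t ≤ a × j ≤ i * t × i * t < j + t)
ceiling-exists {t} {j = j} 0<t (divides I refl) j≤It with ceiling I j≤It
  where
  ceiling : ∀ I → j ≤ I * t → ∃[ i ] (i ≤ I × j ≤ i * t × i * t < j + t)
  ceiling zero    j≤0  = 0 , z≤n , j≤0 , <-≤-trans 0<t (m≤n+m t j)
  ceiling (suc I) j≤[1+I]t with j ≤? I * t
  ... | yes j≤It = let i , i≤I , rest = ceiling I j≤It in i , m≤n⇒m≤1+n i≤I , rest
  ... | no  j≰It =
    suc I , ≤-refl , j≤[1+I]t , subst (t + I * t <_) (+-comm t j) (+-monoʳ-< t (≰⇒> j≰It))
... | i , i≤I , j≤it , it<j+t = i , *-monoˡ-≤ t i≤I , j≤it , it<j+t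

ceiling-overshoot : ∀ {t j k l} → k < l → j ≤ k * t → ¬ (l * t < j + t)
ceiling-overshoot {t} {j} {k} k<l j≤kt lt<j+t =
  <⇒≱ lt<j+t (≤-trans (subst (j + t ≤_) (+-comm (k * t) t) (+-monoˡ-≤ t j≤kt)) (*-monoˡ-≤ t k<l))

ceiling-unique : ∀ {t j} i₁ i₂ → j ≤ i₁ * t → i₁ * t < j + t → j ≤ i₂ * t → i₂ * t < j + t → i₁ ≡ i₂
ceiling-unique i₁ i₂ j≤i₁t i₁t<j+t j≤i₂t i₂t<j+t with <-cmp i₁ i₂
... | tri≈ _ i₁≡i₂ _ = i₁≡i₂
... | tri< i₁<i₂ _ _ = ⊥-elim (ceiling-overshoot i₁<i₂ j≤i₁t i₂t<j+t)
... | tri> _ _ i₂<i₁ = ⊥-elim (ceiling-overshoot i₂<i₁ j≤i₂t i₁t<j+t)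

module PrimePowerProduct {P : Pred ℕ 0ℓ} (P? : Decidable P) (P⇒prime : ∀ {q} → P q → Prime q)
                         (K : ℕ → ℕ) where
  open FiniteSums *-1-commutativeMonoid

  primePowerProduct : ℕ → ℕ
  primePowerProduct n = sumTo n (λ q → when (P? q) (q ^ K q))

  prime∤primePowerProduct : ∀ n {p} → Prime p → n < p → ¬ p ∣ primePowerProduct n
  prime∤primePowerProduct zero    pr _ p∣1 = <⇒≢ (prime>1 pr) (sym (∣1⇒≡1 p∣1))
  prime∤primePowerProduct (suc n) {p} pr n<p p∣Π with euclidsLemma _ _ pr p∣Π
  ... | inj₁ p∣Πn = prime∤primePowerProduct n pr (<-trans (n<1+n n) n<p) p∣Πn
  ... | inj₂ p∣last with P? (suc n)
  ...   | yes Pn = <⇒≢ n<p (sym (prime∣^⇒≡ (K (suc n)) pr (P⇒prime Pn) p∣last))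
  ...   | no _   = <⇒≢ (prime>1 pr) (sym (∣1⇒≡1 p∣last))

  primePowerProduct-∣⇒ : ∀ n {d} → primePowerProduct n ∣ d → ∀ q → P q → q ≤ n → q ^ K q ∣ d
  primePowerProduct-∣⇒ zero    _  q Pq q≤0 = ⊥-elim (<⇒≱ (prime>1 (P⇒prime Pq)) (≤-trans q≤0 z≤n))
  primePowerProduct-∣⇒ (suc n) Π∣d q Pq q≤1+n with m≤n⇒m<n∨m≡n q≤1+n
  ... | inj₁ q<1+n = primePowerProduct-∣⇒ n (m*n∣⇒m∣ _ _ Π∣d) q Pq (≤-pred q<1+n)
  ... | inj₂ refl with P? q
  ...   | yes _ = m*n∣⇒n∣ (primePowerProduct n) _ Π∣d
  ...   | no ¬Pq = ⊥-elim (¬Pq Pq)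

  primePowerProduct-∣⇐ : ∀ n {d} → (∀ q → P q → q ≤ n → q ^ K q ∣ d) → primePowerProduct n ∣ d
  primePowerProduct-∣⇐ zero    _ = 1∣ _
  primePowerProduct-∣⇐ (suc n) {d} all∣ = with-last (P? (suc n))
    where
    Πn∣d : primePowerProduct n ∣ d
    Πn∣d = primePowerProduct-∣⇐ n (λ q Pq q≤n → all∣ q Pq (m≤n⇒m≤1+n q≤n))
    with-last : (Pn? : Dec (P (suc n))) → primePowerProduct n * when Pn? (suc n ^ K (suc n)) ∣ d
    with-last (yes Pn) = coprime-*∣ (coprime-sym (coprime-^ (K (suc n)) (P⇒prime Pn)
                                       (prime∤primePowerProduct n (P⇒prime Pn) ≤-refl)))
                                    Πn∣d (all∣ (suc n) Pn ≤-refl)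
    with-last (no _)   = subst (_∣ d) (sym (*-identityʳ _)) Πn∣d

-- Regular systems of divisors

module _ (A : RegularSystem) where
  open RegularSystem A

  coreExponent : ℕ → ℕ → ℕ
  coreExponent q e = v q e ∸ type q (v q e) + 1

  CoreDivides : ℕ → ℕ → Set
  CoreDivides e d = ∀ q → Prime q → q ∣ e → coreExponent q e ≤ v q d

  private
    module CoreProduct (e : ℕ) =
      PrimePowerProduct (λ p → prime? p ×-dec p ∣? e) proj₁ (λ p → coreExponent p e)

  core≡primePowerProduct : ∀ e → core A e ≡ CoreProduct.primePowerProduct e e
  core≡primePowerProduct e = FiniteSums.sumList-filter-range1 *-1-commutativeMonoid _ _ e

  core∣⇒CoreDivides : ∀ {e d} → 0 < e → 0 < d → core A e ∣ d → CoreDivides e d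
  core∣⇒CoreDivides {e} {d} 0<e 0<d γ∣d q pq q∣e =
    ^∣⇒≤ pq (v-∥ pq 0<d)
      (CoreProduct.primePowerProduct-∣⇒ e e (subst (_∣ d) (core≡primePowerProduct e) γ∣d) q (pq , q∣e)
        (∣⇒≤ {{>-nonZero 0<e}} q∣e))

  CoreDivides⇒core∣ : ∀ {e d} → 0 < d → CoreDivides e d → core A e ∣ d
  CoreDivides⇒core∣ {e} {d} 0<d γ∣ᵛd = subst (_∣ d) (sym (core≡primePowerProduct e))
    (CoreProduct.primePowerProduct-∣⇐ e e (λ { q (pq , q∣e) _ → ≤⇒^∣ (v-∥ pq 0<d) (γ∣ᵛd q pq q∣e) }))

  type>0 : ∀ {q a} → Prime q → 0 < a → 0 < type q a
  type>0 {q} {a} pq 0<a = ∣⇒>0 (type-div q a pq 0<a) 0<a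

  ∈A-^ : ∀ {q a} → Prime q → 0 < a → ∀ k →
         (k ∈A (q ^ a)) ⇔ (∃[ i ] (i * type q a ≤ a × k ≡ q ^ (i * type q a)))
  ∈A-^ {q} {a} pq 0<a k with type-div q a pq 0<a
  ... | divides I a≡It = mk⇔
    (λ k∈ → let i , i≤I , k≡ = to members (subst (λ x → k ∈A (q ^ x)) a≡It k∈)
            in i , subst (i * t ≤_) (sym a≡It) (*-monoˡ-≤ t i≤I) , k≡)
    (λ { (i , it≤a , k≡) → subst (λ x → k ∈A (q ^ x)) (sym a≡It)
            (from members (i , *-cancelʳ-≤ i I t {{>-nonZero (type>0 pq 0<a)}} (subst (i * t ≤_) a≡It it≤a) ,
                           k≡)) })
    where
    t : ℕ
    t = type q a
    members : (k ∈A (q ^ (I * t))) ⇔ (∃[ j ] (j ≤ I × k ≡ q ^ (j * t)))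
    members = type-pow q a pq 0<a I (≤-reflexive (sym a≡It)) k

  type-stable : ∀ {q a i} → Prime q → 0 < a → 0 < i → i * type q a ≤ a →
                type q (i * type q a) ≡ type q a
  type-stable {q} {a} {i} pq 0<a 0<i it≤a = ∣-antisym s∣t t∣s
    where
    t b : ℕ
    t = type q a
    b = i * t
    0<b : 0 < b
    0<b = *-mono-≤ 0<i (type>0 pq 0<a)
    s : ℕ
    s = type q b
    s∣t : s ∣ t
    s∣t with to (∈A-^ pq 0<b (q ^ t))
                (from (type-pow q a pq 0<a i it≤a (q ^ t)) (1 , 0<i , cong (q ^_) (sym (*-identityˡ t))))
    ... | j , _ , q^t≡q^js = divides j (^-injective t (j * s) pq q^t≡q^js)
    1*s≤b : 1 * s ≤ b
    1*s≤b = ≤-trans (≤-reflexive (*-identityˡ s)) (∣⇒≤ {{>-nonZero 0<b}} (type-div q b pq 0<b))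
    t∣s : t ∣ s
    t∣s with to (type-pow q a pq 0<a i it≤a (q ^ s))
                (from (∈A-^ pq 0<b (q ^ s)) (1 , 1*s≤b , cong (q ^_) (sym (*-identityˡ s))))
    ... | j , _ , q^s≡q^jt = divides j (^-injective s (j * t) pq q^s≡q^jt)

  ∈A-^* : ∀ {q a m} → Prime q → 0 < a → ¬ q ∣ m → ∀ k →
          (k ∈A (q ^ a * m)) ⇔ (∃[ i ] ∃[ y ] (i * type q a ≤ a × y ∈A m × k ≡ q ^ (i * type q a) * y))
  ∈A-^* {q} {a} {m} pq 0<a q∤m k = mk⇔
    (λ k∈ → let x , y , x∈ , y∈ , k≡xy = to split k∈
                i , it≤a , x≡ = to (∈A-^ pq 0<a x) x∈
            in i , y , it≤a , y∈ , trans k≡xy (cong (_* y) x≡))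
    (λ { (i , y , it≤a , y∈ , k≡) →
           from split (_ , y , from (∈A-^ pq 0<a _) (i , it≤a , refl) , y∈ , k≡) })
    where
    split : (k ∈A (q ^ a * m)) ⇔ (∃[ x ] ∃[ y ] (x ∈A (q ^ a) × y ∈A m × k ≡ x * y))
    split = mult (q ^ a) m (m^n>0 q {{prime⇒nonZero pq}} a) (∤⇒>0 q∤m) (coprime-^ a pq q∤m) k

  coreExponent-^*-≢ : ∀ {r q y} b → Prime r → Prime q → r ≢ q → 0 < y →
                      coreExponent r (q ^ b * y) ≡ coreExponent r y
  coreExponent-^*-≢ b pr pq r≢q 0<y = cong (λ w → w ∸ type _ w + 1) (v-^*-≢ b pr pq r≢q 0<y)

  CoreDivides-^* : ∀ {q y d'} b j → Prime q → ¬ q ∣ y → ¬ q ∣ d' →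
                   CoreDivides (q ^ b * y) (q ^ j * d') ⇔
                   ((q ∣ q ^ b * y → coreExponent q (q ^ b * y) ≤ j) × CoreDivides y d')
  CoreDivides-^* {q} {y} {d'} b j pq q∤y q∤d' = mk⇔
    (λ γ∣d → (λ q∣e → subst (_ ≤_) (v-^* j pq q∤d') (γ∣d q pq q∣e)) ,
             (λ r pr r∣y → at-other-prime (r≢q r∣y) pr (γ∣d r pr (∣-trans r∣y (n∣m*n (q ^ b))))))
    (λ { (γ∣ᵛq , γ∣d') r pr r∣e → case-prime r pr r∣e γ∣ᵛq γ∣d' })
    where
    r≢q : ∀ {r} → r ∣ y → r ≢ q
    r≢q r∣y refl = q∤y r∣y
    v-d : ∀ {r} → Prime r → r ≢ q → v r (q ^ j * d') ≡ v r d'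
    v-d pr r≢q = v-^*-≢ j pr pq r≢q (∤⇒>0 q∤d')
    at-other-prime : ∀ {r} → r ≢ q → Prime r →
                     coreExponent r (q ^ b * y) ≤ v r (q ^ j * d') → coreExponent r y ≤ v r d'
    at-other-prime r≢q pr =
      subst₂ _≤_ (coreExponent-^*-≢ b pr pq r≢q (∤⇒>0 q∤y)) (v-d pr r≢q)
    case-prime : ∀ r → Prime r → r ∣ q ^ b * y →
                 (q ∣ q ^ b * y → coreExponent q (q ^ b * y) ≤ j) → CoreDivides y d' →
                 coreExponent r (q ^ b * y) ≤ v r (q ^ j * d')
    case-prime r pr r∣e γ∣ᵛq γ∣d' with r ≟ q
    ... | yes refl = subst (_ ≤_) (sym (v-^* j pq q∤d')) (γ∣ᵛq r∣e)
    ... | no r≢q with euclidsLemma (q ^ b) y pr r∣e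
    ...   | inj₁ r∣q^b = ⊥-elim (r≢q (prime∣^⇒≡ b pr pq r∣q^b))
    ...   | inj₂ r∣y   =
      subst₂ _≤_ (sym (coreExponent-^*-≢ b pr pq r≢q (∤⇒>0 q∤y))) (sym (v-d pr r≢q)) (γ∣d' r pr r∣y)

  coreExponent-^* : ∀ {q a y} i₀ → Prime q → 0 < a → ¬ q ∣ y → suc i₀ * type q a ≤ a →
                    coreExponent q (q ^ (suc i₀ * type q a) * y) ≡ suc (i₀ * type q a)
  coreExponent-^* {q} {a} {y} i₀ pq 0<a q∤y it≤a = begin
    v q e ∸ type q (v q e) + 1  ≡⟨ cong (λ w → w ∸ type q w + 1) (v-^* (suc i₀ * t) pq q∤y) ⟩
    b ∸ type q b + 1            ≡⟨ cong (λ s → b ∸ s + 1) (type-stable {i = suc i₀} pq 0<a (s≤s z≤n) it≤a) ⟩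
    t + i₀ * t ∸ t + 1          ≡⟨ cong (_+ 1) (m+n∸m≡n t (i₀ * t)) ⟩
    i₀ * t + 1                  ≡⟨ +-comm (i₀ * t) 1 ⟩
    suc (i₀ * t)                ∎
    where
    open ≡-Reasoning
    t b e : ℕ
    t = type q a
    b = suc i₀ * t
    e = q ^ b * y

  coreCondition-^*⇔ : ∀ {q a y j} i → Prime q → 0 < a → ¬ q ∣ y → i * type q a ≤ a →
                      (q ∣ q ^ (i * type q a) * y → coreExponent q (q ^ (i * type q a) * y) ≤ j) ⇔
                      (i * type q a < j + type q a)
  coreCondition-^*⇔ {q} {a} {y} {j} zero pq 0<a q∤y _ = mk⇔
    (λ _ → <-≤-trans (type>0 pq 0<a) (m≤n+m (type q a) j))
    (λ _ q∣y → ⊥-elim (q∤y (subst (q ∣_) (*-identityˡ y) q∣y)))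
  coreCondition-^*⇔ {q} {a} {y} {j} (suc i₀) pq 0<a q∤y it≤a = mk⇔
    (λ γ∣ᵛq → subst (t + i₀ * t <_) (+-comm t j)
                (+-monoʳ-< t (subst (_≤ j) (coreExponent-^* i₀ pq 0<a q∤y it≤a) (γ∣ᵛq q∣e))))
    (λ it<j+t _ → subst (_≤ j) (sym (coreExponent-^* i₀ pq 0<a q∤y it≤a))
                    (+-cancelˡ-< t (i₀ * t) j (subst (t + i₀ * t <_) (+-comm j t) it<j+t)))
    where
    t : ℕ
    t = type q a
    q∣e : q ∣ q ^ (suc i₀ * t) * y
    q∣e = ∣^* q (suc i₀ * t) y (*-mono-≤ {1} {suc i₀} (s≤s z≤n) (type>0 pq 0<a))

  Cover : ℕ → ℕ → ℕ → Set
  Cover n d e = e ∈A n × d ∣ e × CoreDivides e d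

  cover-^*⇔ : ∀ {q a m d' y} i j → Prime q → 0 < a → ¬ q ∣ m → ¬ q ∣ d' →
              i * type q a ≤ a → y ∈A m →
              Cover (q ^ a * m) (q ^ j * d') (q ^ (i * type q a) * y) ⇔
              (j ≤ i * type q a × i * type q a < j + type q a × Cover m d' y)
  cover-^*⇔ {q} {a} {m} {d'} {y} i j pq 0<a q∤m q∤d' it≤a y∈ = mk⇔
    (λ { (_ , d∣e , γ∣d) →
       let j≤it , d'∣y = ^*∣^*⇒ pq q∤d' q∤y d∣e
           γ∣ᵛq , γ∣d' = to (CoreDivides-^* (i * t) j pq q∤y q∤d') γ∣d
       in j≤it , to (coreCondition-^*⇔ i pq 0<a q∤y it≤a) γ∣ᵛq , y∈ , d'∣y , γ∣d' })
    (λ { (j≤it , it<j+t , _ , d'∣y , γ∣d') →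
       from (∈A-^* pq 0<a q∤m _) (i , y , it≤a , y∈ , refl) ,
       ^*∣^*⇐ j≤it d'∣y ,
       from (CoreDivides-^* (i * t) j pq q∤y q∤d')
            (from (coreCondition-^*⇔ i pq 0<a q∤y it≤a) it<j+t , γ∣d') })
    where
    t : ℕ
    t = type q a
    q∤y : ¬ q ∣ y
    q∤y q∣y = q∤m (∣-trans q∣y (sub (∤⇒>0 q∤m) y∈))

  cover⇒>0 : ∀ {n d e} → 0 < n → Cover n d e → 0 < d
  cover⇒>0 0<n (e∈ , d∣e , _) = ∣⇒>0 d∣e (∣⇒>0 (sub 0<n e∈) 0<n)

  CoreDivides-1 : ∀ d → CoreDivides 1 d
  CoreDivides-1 d q pq q∣1 = ⊥-elim (¬prime[1] (subst Prime (∣1⇒≡1 q∣1) pq))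

  cover-exists : ∀ n → 0 < n → ∀ {d} → d ∣ n → ∃[ e ] Cover n d e
  cover-exists = factor-induction (λ n → ∀ {d} → d ∣ n → ∃[ e ] Cover n d e)
    (λ {d} d∣1 → 1 , from (one 1) refl , d∣1 , CoreDivides-1 d)
    step
    where
    step : ∀ {q a m} → Prime q → 0 < a → ¬ q ∣ m → (∀ {d} → d ∣ m → ∃[ e ] Cover m d e) →
           ∀ {d} → d ∣ q ^ a * m → ∃[ e ] Cover (q ^ a * m) d e
    step {q} {a} {m} pq 0<a q∤m IH {d} d∣n
      with v q d | v-∥ {n = d} pq (∣⇒>0 d∣n (^*>0 a pq (∤⇒>0 q∤m)))
    ... | j | d' , refl , q∤d' with ^*∣^*⇒ pq q∤d' q∤m d∣n
    ... | j≤a , d'∣m with IH d'∣m | ceiling-exists (type>0 pq 0<a) (type-div q a pq 0<a) j≤a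
    ... | y , y∈ , d'∣y , γ∣d' | i , it≤a , j≤it , it<j+t =
      q ^ (i * type q a) * y ,
      from (cover-^*⇔ i j pq 0<a q∤m q∤d' it≤a y∈) (j≤it , it<j+t , y∈ , d'∣y , γ∣d')

  cover-unique : ∀ n → 0 < n → ∀ {d e₁ e₂} → Cover n d e₁ → Cover n d e₂ → e₁ ≡ e₂
  cover-unique = factor-induction (λ n → ∀ {d e₁ e₂} → Cover n d e₁ → Cover n d e₂ → e₁ ≡ e₂)
    (λ (e₁∈ , _) (e₂∈ , _) → trans (to (one _) e₁∈) (sym (to (one _) e₂∈)))
    step
    where
    step : ∀ {q a m} → Prime q → 0 < a → ¬ q ∣ m →
           (∀ {d e₁ e₂} → Cover m d e₁ → Cover m d e₂ → e₁ ≡ e₂) →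
           ∀ {d e₁ e₂} → Cover (q ^ a * m) d e₁ → Cover (q ^ a * m) d e₂ → e₁ ≡ e₂
    step {q} {a} {m} pq 0<a q∤m IH {d} c₁@(e₁∈ , _) c₂@(e₂∈ , _)
      with to (∈A-^* pq 0<a q∤m _) e₁∈ | to (∈A-^* pq 0<a q∤m _) e₂∈
         | v q d | v-∥ {n = d} pq (cover⇒>0 (^*>0 a pq (∤⇒>0 q∤m)) c₁)
    ... | i₁ , y₁ , i₁t≤a , y₁∈ , refl | i₂ , y₂ , i₂t≤a , y₂∈ , refl | j | d' , refl , q∤d'
      with to (cover-^*⇔ i₁ j pq 0<a q∤m q∤d' i₁t≤a y₁∈) c₁
         | to (cover-^*⇔ i₂ j pq 0<a q∤m q∤d' i₂t≤a y₂∈) c₂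
    ... | j≤i₁t , i₁t<j+t , c₁' | j≤i₂t , i₂t<j+t , c₂' =
      cong₂ (λ i y → q ^ (i * type q a) * y)
            (ceiling-unique i₁ i₂ j≤i₁t i₁t<j+t j≤i₂t i₂t<j+t) (IH c₁' c₂')

  ∈A-refl : ∀ {n} → 0 < n → n ∈A n
  ∈A-refl {n} 0<n with cover-exists n 0<n ∣-refl
  ... | e , e∈ , n∣e , _ = subst (_∈A n) (∣-antisym (sub 0<n e∈) n∣e) e∈

module Inversion {c ℓ : Level} (G : AbelianGroup c ℓ) (A : RegularSystem) where
  open AbelianGroup G renaming (refl to ≈-refl; sym to ≈-sym; trans to ≈-trans)
  open RegularSystem A
  open FiniteSums commutativeMonoid
  open Sums G using (sumDiv; sumA; sumDivMult)
  open import Algebra.Properties.Group group using (∙-cancelˡ)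
  open import Relation.Binary.Reasoning.Setoid setoid

  covers? : ∀ e d → Dec (d ∣ e × core A e ∣ d)
  covers? e d = (d ∣? e) ×-dec (core A e ∣? d)

  coreSum : (ℕ → Carrier) → ℕ → Carrier
  coreSum g e = sumDivMult e (core A e) g

  coreSum≈sumTo : ∀ g {e k} → 0 < e → e ≤ k → coreSum g e ≈ sumTo k (λ d → when (covers? e d) (g d))
  coreSum≈sumTo g {e} 0<e e≤k =
    ≈-trans (sumList-filter-range1 (covers? e) g e) (sumTo-extend e≤k vanish)
    where
    vanish : ∀ d → e < d → d ≤ _ → when (covers? e d) (g d) ≈ ε
    vanish d e<d _ with covers? e d
    ... | yes (d∣e , _) = ⊥-elim (<⇒≱ e<d (∣⇒≤ {{>-nonZero 0<e}} d∣e))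
    ... | no _          = ≈-refl

  module _ (g : ℕ → Carrier) {k : ℕ} (0<k : 0 < k) where

    summand : ℕ → ℕ → Carrier
    summand e d = when (e ∈A? k) (when (covers? e d) (g d))

    summand-cover : ∀ {e d} → e ∈A k → d ∣ e → core A e ∣ d → summand e d ≈ g d
    summand-cover {e} {d} e∈ d∣e γ∣d with e ∈A? k | covers? e d
    ... | yes _   | yes _   = ≈-refl
    ... | no e∉   | _       = ⊥-elim (e∉ e∈)
    ... | yes _   | no ¬cov = ⊥-elim (¬cov (d∣e , γ∣d))

    summand-ε : ∀ {e d} → ¬ (e ∈A k × d ∣ e × core A e ∣ d) → summand e d ≈ ε
    summand-ε {e} {d} ¬cov with e ∈A? k | covers? e d
    ... | yes e∈ | yes (d∣e , γ∣d) = ⊥-elim (¬cov (e∈ , d∣e , γ∣d))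
    ... | yes _  | no _            = ≈-refl
    ... | no _   | _               = ≈-refl

    row : ∀ e → 0 < e → e ≤ k → when (e ∈A? k) (coreSum g e) ≈ sumTo k (λ d → summand e d)
    row e 0<e e≤k with e ∈A? k
    ... | yes _ = coreSum≈sumTo g 0<e e≤k
    ... | no _  = ≈-sym (sumTo-ε k (λ _ _ _ → ≈-refl))

    column : ∀ d → 0 < d → d ≤ k → sumTo k (λ e → summand e d) ≈ when (d ∣? k) (g d)
    column d 0<d d≤k with d ∣? k
    ... | no d∤k = sumTo-ε k (λ e _ _ → summand-ε (λ (e∈ , d∣e , _) → d∤k (∣-trans d∣e (sub 0<k e∈))))
    ... | yes d∣k with cover-exists A k 0<k d∣k
    ...   | w , w∈ , d∣w , γ∣ᵛd =
      ≈-trans (sumTo-single k w (∣⇒>0 (sub 0<k w∈) 0<k) (∣⇒≤ {{>-nonZero 0<k}} (sub 0<k w∈)) other)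
              (summand-cover w∈ d∣w (CoreDivides⇒core∣ A 0<d γ∣ᵛd))
      where
      other : ∀ e → 0 < e → e ≤ k → e ≢ w → summand e d ≈ ε
      other e 0<e _ e≢w = summand-ε (λ (e∈ , d∣e , γ∣d) →
        e≢w (cover-unique A k 0<k (e∈ , d∣e , core∣⇒CoreDivides A 0<e 0<d γ∣d) (w∈ , d∣w , γ∣ᵛd)))

  sumA-coreSum : ∀ g k → 0 < k → sumA A k (coreSum g) ≈ sumDiv k g
  sumA-coreSum g k 0<k = begin
    sumA A k (coreSum g)                               ≈⟨ sumList-filter-range1 (_∈A? k) (coreSum g) k ⟩
    sumTo k (λ e → when (e ∈A? k) (coreSum g e))       ≈⟨ sumTo-cong k (row g 0<k) ⟩
    sumTo k (λ e → sumTo k (λ d → summand g 0<k e d))  ≈⟨ sumTo-comm k k (summand g 0<k) ⟩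
    sumTo k (λ d → sumTo k (λ e → summand g 0<k e d))  ≈⟨ sumTo-cong k (column g 0<k) ⟩
    sumTo k (λ d → when (d ∣? k) (g d))                ≈⟨ sumList-filter-range1 (_∣? k) g k ⟨
    sumDiv k g                                         ∎

  sumA-injective : ∀ {x y : ℕ → Carrier} → (∀ n → 0 < n → sumA A n x ≈ sumA A n y) →
                   ∀ n → 0 < n → x n ≈ y n
  sumA-injective {x} {y} sumA≈ = <-rec (λ n → 0 < n → x n ≈ y n) step
    where
    restricted : ℕ → (ℕ → Carrier) → ℕ → Carrier
    restricted n f e = when (e ∈A? n) (f e)
    last : ∀ n f → restricted (suc n) f (suc n) ≈ f (suc n)
    last n f with suc n ∈A? suc n
    ... | yes _   = ≈-refl
    ... | no 1+n∉ = ⊥-elim (1+n∉ (∈A-refl A (s≤s z≤n)))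
    step : ∀ n → (∀ {m} → m < n → 0 < m → x m ≈ y m) → 0 < n → x n ≈ y n
    step (suc n) IH _ = ∙-cancelˡ (sumTo n (restricted (suc n) x)) (x (suc n)) (y (suc n)) (begin
      sumTo n (restricted (suc n) x) ∙ x (suc n)  ≈⟨ ∙-congˡ (last n x) ⟨
      sumTo (suc n) (restricted (suc n) x)        ≈⟨ sumList-filter-range1 (_∈A? suc n) x (suc n) ⟨
      sumA A (suc n) x                            ≈⟨ sumA≈ (suc n) (s≤s z≤n) ⟩
      sumA A (suc n) y                            ≈⟨ sumList-filter-range1 (_∈A? suc n) y (suc n) ⟩
      sumTo (suc n) (restricted (suc n) y)        ≈⟨ ∙-cong (sumTo-cong n earlier) (last n y) ⟩
      sumTo n (restricted (suc n) x) ∙ y (suc n)  ∎)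
      where
      earlier : ∀ e → 0 < e → e ≤ n → restricted (suc n) y e ≈ restricted (suc n) x e
      earlier e 0<e e≤n with e ∈A? suc n
      ... | yes _ = ≈-sym (IH (s≤s e≤n) 0<e)
      ... | no _  = ≈-refl

theorem3 : {c ℓ : Level} (G : AbelianGroup c ℓ) (A : RegularSystem)
           (g gA : ℕ → AbelianGroup.Carrier G) →
           (∀ n → 1 ≤ n → AbelianGroup._≈_ G (Sums.sumDiv G n g) (Sums.sumA G A n gA)) →
           ∀ n → 1 ≤ n → AbelianGroup._≈_ G (gA n) (Sums.sumDivMult G n (core A n) g)
theorem3 G A g gA sumDiv≈sumA =
  sumA-injective (λ n 0<n → ≈-trans (≈-sym (sumDiv≈sumA n 0<n)) (≈-sym (sumA-coreSum g n 0<n)))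
  where
  open AbelianGroup G using () renaming (trans to ≈-trans; sym to ≈-sym)
  open Inversion G A
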